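{- Let $k\geq 1$ be an integer and let $C_N$ be the cycle on $N$ vertices (with a loop at every vertex), where the target moves at most $k$ steps after each test. Then: (i) if $1\leq N\leq 4k$, there is no $(C_N,s)$-successful strategy with $s<N$, i.e. $s^*(C_N)=N$; (ii) if $N\geq 4k+1$, there is no $(C_N,s)$-successful strategy with $s\leq 4k$, i.e. $s^*(C_N)\geq 4k+1$.
   Context: Search model: $G$ is a finite graph on vertex set $\{1,\dots,N\}$ with a loop at every vertex. For $\mathcal A\subseteq\{1,\dots,N\}$, $\Gamma_k(\mathcal A)$ is the set of vertices $j$ such that for some $i\in\mathcal A$ there is a path (walk) from $i$ to $j$ in $G$ of length at most $k$ (so $\mathcal A\subseteq\Gamma_k(\mathcal A)$). An unknown target occupies a vertex; a searcher performs tests $\mathcal T_1,\dots,\mathcal T_n\subseteq\{1,\dots,N\}$ one after another; test $i$ returns $y_i=1$ if the target currently lies in $\mathcal T_i$ and $y_i=0$ otherwise; after each test the target moves along a walk of length at most $k$. In an (adaptive) strategy, $\mathcal T_i$ may depend on $y_1,\dots,y_{i-1}$. The sets of possible positions are $\mathcal D_0=\{1,\dots,N\}$ and $\mathcal D_i=\Gamma_k(\mathcal T_i\cap\mathcal D_{i-1})$ if $y_i=1$, $\mathcal D_i=\Gamma_k(\mathcal D_{i-1}\setminus\mathcal T_i)$ if $y_i=0$. A strategy with $n$ tests is $(G,s)$-successful if for every sequence of test results, $|\mathcal D_i|\leq s$ for some $i\in\{0,\dots,n\}$. $s^*(G)$ is the minimum $s$ for which some $(G,s)$-successful strategy (with any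 number of tests) exists. The cycle $C_N$ has vertex set $\{1,\dots,N\}$ and edges $\{i,i+1\}$ for $1\leq i<N$, the edge $\{N,1\}$, and a loop at every vertex. -}

module Defs where

open import Data.Bool using (Bool; true; false; _∧_; _∨_)
open import Data.Nat using (ℕ; zero; suc; _≡ᵇ_; _∸_)
open import Data.Fin using (Fin; toℕ)
open import Data.Fin.Subset using (Subset; ⊤; _∩_; _─_; ∣_∣)
open import Data.Vec using (tabulate; lookup)
open import Data.Nat using (_≤_)
open import Data.Product using (_×_)
open import Data.Sum using (_⊎_)
open import Function using (_∘_)

-- A graph on the vertex set Fin N (vertices 0..N-1 correspond to 1..N),
-- given by a Boolean adjacency relation.
Graph : ℕ → Set
Graph N = Fin N → Fin N → Bool

anyFin : ∀ {N} → (Fin N → Bool) → Bool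
anyFin {zero}  f = false
anyFin {suc N} f = f Fin.zero ∨ anyFin (f ∘ Fin.suc)

-- The cycle C_N with a loop at every vertex: j ~ i iff j = i, j = i+1, or
-- i = j+1 (indices taken cyclically, vertex N-1 adjacent to vertex 0).
nextB : ℕ → ℕ → ℕ → Bool
nextB N a b = (b ≡ᵇ suc a) ∨ ((a ≡ᵇ (N ∸ 1)) ∧ (b ≡ᵇ 0))

cycle : (N : ℕ) → Graph N
cycle N i j = (toℕ i ≡ᵇ toℕ j) ∨ nextB N (toℕ i) (toℕ j) ∨ nextB N (toℕ j) (toℕ i)

Γ₁ : ∀ {N} → Graph N → Subset N → Subset N
Γ₁ G A = tabulate (λ j → anyFin (λ i → lookup A i ∧ G i j))

-- Γ_k(A): vertices reachable from A by a walk of length at most k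
-- (iterating Γ₁ k times; the loops make "at most k" = "exactly k").
Γ : ∀ {N} → Graph N → ℕ → Subset N → Subset N
Γ G zero    A = A
Γ G (suc k) A = Γ G k (Γ₁ G A)

-- Adaptive strategies with exactly n tests: a binary decision tree.
-- `test T s₀ s₁` performs test T, continuing with s₀ if y = 0, s₁ if y = 1.
data Strategy (N : ℕ) : ℕ → Set where
  done : Strategy N zero
  test : ∀ {n} → Subset N → Strategy N n → Strategy N n → Strategy N (suc n)

Successful : ∀ {N} → Graph N → ℕ → ℕ → Subset N → ∀ {n} → Strategy N n → Set
Successful G k s D done           = ∣ D ∣ ≤ s
Successful G k s D (test T σ₀ σ₁) =
  ∣ D ∣ ≤ s ⊎ (Successful G k s (Γ G k (D ─ T)) σ₀ × Successful G k s (Γ G k (T ∩ D)) σ₁)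

GSuccessful : ∀ {N} → Graph N → ℕ → ℕ → ∀ {n} → Strategy N n → Set
GSuccessful {N} G k s σ = Successful G k s ⊤ σ

-- Call an arc a run of 4k+1 consecutive vertices of C_N (read cyclically, so for N ≤ 4k+1 an
-- arc is all of C_N); it has min(N, 4k+1) elements. If the set D of possible positions contains
-- an arc, so does one of Γ_k(D ∖ T), Γ_k(T ∩ D), whatever the test T; as D₀ is everything, no
-- D_i ever has fewer than min(N, 4k+1) elements. For the invariant, split the arc at positions
-- 0..4k into the part X containing position 0 and the rest Y. If 2k+1 consecutive positions
-- starting at some j ≤ 2k lie in Y, their k-neighbourhood is an arc. Otherwise every window of
-- 2k+1 positions starting at j ≤ 2k meets X, so the k-neighbourhood of X covers positions
-- −k..3k, again an arc.
module Submission where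

open import Defs
open import Data.Bool using (Bool; T; _∨_)
open import Data.Bool.Properties using (T-≡; T-∧; T-∨)
open import Data.List using ([]; _∷_)
open import Data.Fin using (Fin; toℕ; fromℕ<)
open import Data.Fin.Properties using (toℕ-fromℕ<; toℕ-injective)
open import Data.Fin.Subset using (Subset; ⊤; _∩_; _─_; _-_; ∣_∣; _∈_; _∉_; _⊆_)
open import Data.Fin.Subset.Properties
  using (_∈?_; ∈⊤; x∈p∩q⁺; x∈p∧x∉q⇒x∈p─q; x∈p⇒∣p-x∣<∣p∣; x∈p∧x≢y⇒x∈p-y)
open import Data.Nat
  using (ℕ; zero; suc; _≤_; _<_; _+_; _*_; _∸_; _≡ᵇ_; _%_; _≤?_; _<?_; z≤n; s≤s; s≤s⁻¹; z<s)
open import Data.Nat.DivMod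
open import Data.Nat.Properties
open import Data.Nat.Tactic.RingSolver using (solve-∀; solve)
open import Data.Product using (_×_; _,_; ∃)
open import Data.Sum using (_⊎_; inj₁; inj₂; [_,_]; map₂; swap)
open import Data.Vec.Properties using (lookup∘tabulate; []=⇒lookup; lookup⇒[]=)
open import Function using (id; _∘_; _$_; _∋_)
open import Function.Bundles using (Equivalence)
open import Relation.Binary.PropositionalEquality
  using (_≡_; _≢_; refl; sym; trans; cong; subst; module ≡-Reasoning)
open import Relation.Nullary using (¬_; Dec; yes; no; contradiction)
open import Relation.Nullary.Decidable using (¬?; decidable-stable)
open import Relation.Unary using (Decidable)

open Equivalence using (to; from)

∈-split : ∀ {N} {x : Fin N} {D} T → x ∈ D → x ∈ D ─ T ⊎ x ∈ T ∩ D
∈-split {x = x} T x∈D with x ∈? T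
... | yes x∈T = inj₂ (x∈p∩q⁺ (x∈T , x∈D))
... | no  x∉T = inj₁ (x∈p∧x∉q⇒x∈p─q x∈D x∉T)

T-∨-introʳ : ∀ x {y} → T y → T (x ∨ y)
T-∨-introʳ x = from (T-∨ {x}) ∘ inj₂

Reflexive : ∀ {N} → Graph N → Set
Reflexive G = ∀ i → T (G i i)

anyFin-intro : ∀ {N} (f : Fin N → Bool) i → T (f i) → T (anyFin f)
anyFin-intro f Fin.zero    fi = from T-∨ (inj₁ fi)
anyFin-intro f (Fin.suc i) fi = from T-∨ (inj₂ (anyFin-intro (f ∘ Fin.suc) i fi))

module _ {N} (G : Graph N) where

  Γ₁-intro : ∀ {A i j} → i ∈ A → T (G i j) → j ∈ Γ₁ G A
  Γ₁-intro {A} {i} {j} i∈A gij = lookup⇒[]= j (Γ₁ G A) $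
    trans (lookup∘tabulate _ j)
          (to T-≡ (anyFin-intro _ i (from T-∧ (from T-≡ ([]=⇒lookup i∈A) , gij))))

  module _ (refl-G : Reflexive G) where

    ⊆-Γ₁ : ∀ {A} → A ⊆ Γ₁ G A
    ⊆-Γ₁ {x = x} x∈A = Γ₁-intro x∈A (refl-G x)

    ⊆-Γ : ∀ k {A} → A ⊆ Γ G k A
    ⊆-Γ zero    = id
    ⊆-Γ (suc k) = ⊆-Γ k ∘ ⊆-Γ₁

    Γ-walkʳ : (w : ℕ → Fin N) → (∀ n → T (G (w n) (w (suc n)))) →
      ∀ k {A} p d → d ≤ k → w p ∈ A → w (p + d) ∈ Γ G k A
    Γ-walkʳ w step k p zero _ wp rewrite +-identityʳ p = ⊆-Γ k wp
    Γ-walkʳ w step (suc k) p (suc d) (s≤s d≤k) wp rewrite +-suc p d =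
      Γ-walkʳ w step k (suc p) d d≤k (Γ₁-intro wp (step p))

    Γ-walkˡ : (w : ℕ → Fin N) → (∀ n → T (G (w (suc n)) (w n))) →
      ∀ k {A} p d → d ≤ k → w (p + d) ∈ A → w p ∈ Γ G k A
    Γ-walkˡ w step k p zero _ wp rewrite +-identityʳ p = ⊆-Γ k wp
    Γ-walkˡ w step (suc k) p (suc d) (s≤s d≤k) wp rewrite +-suc p d =
      Γ-walkˡ w step k p d d≤k (Γ₁-intro wp (step (p + d)))

-- The points k + q (q ∈ P) have k-neighbourhoods covering [0, 4k].
Dense : ℕ → (ℕ → Set) → Set
Dense k P = ∀ t → t ≤ 4 * k → ∃ λ q → q ≤ t × t ≤ q + 2 * k × P q

Dense-map : ∀ k {P Q : ℕ → Set} → (∀ {q} → P q → Q q) → Dense k P → Dense k Q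
Dense-map k P⇒Q dense t t≤4k with dense t t≤4k
... | q , q≤t , t≤q+2k , Pq = q , q≤t , t≤q+2k , P⇒Q Pq

4k≡2k+2k : ∀ k → 4 * k ≡ 2 * k + 2 * k
4k≡2k+2k = solve-∀

run⇒Dense : ∀ k {Q : ℕ → Set} → (∀ q → q ≤ 2 * k → Q q) → Dense k (λ q → q ≤ 2 * k × Q q)
run⇒Dense k run t t≤4k with t ≤? 2 * k
... | yes t≤2k = t , ≤-refl , m≤m+n t (2 * k) , t≤2k , run t t≤2k
... | no  t≰2k =
  2 * k , <⇒≤ (≰⇒> t≰2k) , subst (t ≤_) (4k≡2k+2k k) t≤4k , ≤-refl , run (2 * k) ≤-refl

module _ {P : ℕ → Set} (P? : Decidable P) (m : ℕ) where

  private
    window? : ∀ j → Dec (∃ λ q → q < suc m × P (j + q))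
    window? j = anyUpTo? (P? ∘ (j +_)) (suc m)

  gap-or-windows : (∃ λ j → j ≤ m × ∀ q → q ≤ m → ¬ P (j + q)) ⊎
                   (∀ j → j ≤ m → ∃ λ q → q ≤ m × P (j + q))
  gap-or-windows with anyUpTo? (¬? ∘ window?) (suc m)
  ... | yes (j , j<1+m , no-window) =
    inj₁ (j , s≤s⁻¹ j<1+m , λ q q≤m Pj+q → no-window (q , s≤s q≤m , Pj+q))
  ... | no no-gap = inj₂ window
    where
    window : ∀ j → j ≤ m → ∃ λ q → q ≤ m × P (j + q)
    window j j≤m with decidable-stable (window? j) (λ no-window → no-gap (j , s≤s j≤m , no-window))
    ... | q , q<1+m , Pj+q = q , s≤s⁻¹ q<1+m , Pj+q

windows⇒Dense : ∀ k {P : ℕ → Set} → P 0 →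
  (∀ j → j ≤ 2 * k → ∃ λ q → q ≤ 2 * k × P (j + q)) → Dense k P
windows⇒Dense k P0 window t t≤4k with t ≤? 2 * k
... | yes t≤2k = 0 , z≤n , t≤2k , P0
... | no  t≰2k with window (t ∸ 2 * k) (m≤n+o⇒m∸n≤o t (2 * k) (subst (t ≤_) (4k≡2k+2k k) t≤4k))
...   | q , q≤2k , Pj+q = t ∸ 2 * k + q , j+q≤t , t≤j+q+2k , Pj+q
  where
  2k≤t : 2 * k ≤ t
  2k≤t = <⇒≤ (≰⇒> t≰2k)
  j+q≤t : t ∸ 2 * k + q ≤ t
  j+q≤t = subst (t ∸ 2 * k + q ≤_) (m∸n+n≡m 2k≤t) (+-monoʳ-≤ (t ∸ 2 * k) q≤2k)
  t≤j+q+2k : t ≤ t ∸ 2 * k + q + 2 * k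
  t≤j+q+2k = subst (_≤ t ∸ 2 * k + q + 2 * k) (m∸n+n≡m 2k≤t)
    (+-monoˡ-≤ (2 * k) (m≤m+n (t ∸ 2 * k) q))

gap-or-Dense : ∀ k {P : ℕ → Set} → Decidable P → P 0 →
  (∃ λ j → j ≤ 2 * k × ∀ q → q ≤ 2 * k → ¬ P (j + q)) ⊎ Dense k P
gap-or-Dense k P? P0 = map₂ (windows⇒Dense k P0) (gap-or-windows P? (2 * k))

module Cycle (M : ℕ) where

  N : ℕ
  N = suc M

  C : Graph N
  C = cycle N

  vtx : ℕ → Fin N
  vtx p = fromℕ< (m%n<n p N)

  toℕ-vtx : ∀ p → toℕ (vtx p) ≡ p % N
  toℕ-vtx p = toℕ-fromℕ< (m%n<n p N)

  vtx-+-*N : ∀ x k → vtx (x + k * N) ≡ vtx x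
  vtx-+-*N x k = toℕ-injective $ begin
    toℕ (vtx (x + k * N)) ≡⟨ toℕ-vtx (x + k * N) ⟩
    (x + k * N) % N       ≡⟨ [m+kn]%n≡m%n x k N ⟩
    x % N                 ≡⟨ toℕ-vtx x ⟨
    toℕ (vtx x)           ∎
    where open ≡-Reasoning

  C-reflexive : Reflexive C
  C-reflexive i = from T-∨ (inj₁ (≡⇒≡ᵇ (toℕ i) (toℕ i) refl))

  suc-% : ∀ p → (suc p % N ≡ 0 × p % N ≡ M) ⊎ suc p % N ≡ suc (p % N)
  suc-% p with suc p % N in eq
  ... | zero  = inj₁ (refl , %-pred-≡0 {p} {N} eq)
  ... | suc r = inj₂ (cong suc (≤-antisym r≤p%N p%N≤r))
    where
    r≤p%N : r ≤ p % N
    r≤p%N = m<[1+n%d]⇒m≤[n%d] p N (subst (r <_) (sym eq) ≤-refl)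
    p%N≤r : p % N ≤ r
    p%N≤r = [1+m%d]≤1+n⇒[m%d]≤n p r N (subst (0 <_) (sym eq) z<s) (≤-reflexive eq)

  nextB-% : ∀ p → T (nextB N (p % N) (suc p % N))
  nextB-% p with suc-% p
  ... | inj₁ (wrap , last) rewrite wrap | last =
    from T-∨ (inj₂ (from T-∧ (≡⇒≡ᵇ M M refl , _)))
  ... | inj₂ succ = from T-∨ (inj₁ (≡⇒≡ᵇ _ _ succ))

  nextB-vtx : ∀ p → T (nextB N (toℕ (vtx p)) (toℕ (vtx (suc p))))
  nextB-vtx p rewrite toℕ-vtx p | toℕ-vtx (suc p) = nextB-% p

  nextB⇒C : ∀ i j → T (nextB N (toℕ i) (toℕ j)) → T (C i j)
  nextB⇒C i j = T-∨-introʳ (toℕ i ≡ᵇ toℕ j) ∘ from T-∨ ∘ inj₁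

  nextB⇒C-sym : ∀ i j → T (nextB N (toℕ i) (toℕ j)) → T (C j i)
  nextB⇒C-sym i j = T-∨-introʳ (toℕ j ≡ᵇ toℕ i) ∘ T-∨-introʳ (nextB N (toℕ j) (toℕ i))

  C-forward : ∀ p → T (C (vtx p) (vtx (suc p)))
  C-forward p = nextB⇒C (vtx p) (vtx (suc p)) (nextB-vtx p)

  C-backward : ∀ p → T (C (vtx (suc p)) (vtx p))
  C-backward p = nextB⇒C-sym (vtx p) (vtx (suc p)) (nextB-vtx p)

  Γ-near : ∀ k {A} a t → a ≤ t + k → t ≤ a + k → vtx a ∈ A → vtx t ∈ Γ C k A
  Γ-near k {A} a t a≤t+k t≤a+k a∈A with ≤-total a t
  ... | inj₁ a≤t = subst (_∈ Γ C k A) (cong vtx (m+[n∸m]≡n a≤t)) $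
    Γ-walkʳ C C-reflexive vtx C-forward k a (t ∸ a) (m≤n+o⇒m∸n≤o t a t≤a+k) a∈A
  ... | inj₂ t≤a = Γ-walkˡ C C-reflexive vtx C-backward k t (a ∸ t) (m≤n+o⇒m∸n≤o a t a≤t+k)
    (subst (_∈ A) (cong vtx (sym (m+[n∸m]≡n t≤a))) a∈A)

  [r+d]%N≢r : ∀ r d → r < N → 0 < d → d < N → (r + d) % N ≢ r
  [r+d]%N≢r r d r<N 0<d d<N eq with r + d <? N
  ... | yes r+d<N = <⇒≢ (m<m+n r 0<d) (sym (trans (sym (m<n⇒m%n≡m r+d<N)) eq))
  ... | no  r+d≮N = <⇒≢ r+d∸N<r (trans (sym (m<n⇒m%n≡m r+d∸N<N)) r+d∸N%N≡r)
    where
    N≤r+d : N ≤ r + d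
    N≤r+d = ≮⇒≥ r+d≮N
    r+d∸N<r : r + d ∸ N < r
    r+d∸N<r = subst (r + d ∸ N <_) (m+n∸n≡m r N) (∸-monoˡ-< (+-monoʳ-< r d<N) N≤r+d)
    r+d∸N<N : r + d ∸ N < N
    r+d∸N<N = <-trans r+d∸N<r r<N
    r+d∸N%N≡r : (r + d ∸ N) % N ≡ r
    r+d∸N%N≡r = trans (m≤n⇒[n∸m]%m≡n%m N≤r+d) eq

  [m+d]%N≢m%N : ∀ m d → 0 < d → d < N → (m + d) % N ≢ m % N
  [m+d]%N≢m%N m d 0<d d<N = [r+d]%N≢r (m % N) d (m%n<n m N) 0<d d<N ∘ trans (sym reduce)
    where
    reduce : (m + d) % N ≡ (m % N + d) % N
    reduce = trans (%-distribˡ-+ m d N) (cong (λ x → (m % N + x) % N) (m<n⇒m%n≡m d<N))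

  vtx-injective-on-arc : ∀ u {p m} → p < m → m < N → vtx (u + p) ≢ vtx (u + m)
  vtx-injective-on-arc u {p} {m} p<m m<N eq =
    [m+d]%N≢m%N (u + p) (m ∸ p) (m<n⇒0<n∸m p<m) (≤-<-trans (m∸n≤m m p) m<N) $ begin
      (u + p + (m ∸ p)) % N ≡⟨ cong (_% N) (+-assoc u p (m ∸ p)) ⟩
      (u + (p + (m ∸ p))) % N ≡⟨ cong (λ x → (u + x) % N) (m+[n∸m]≡n (<⇒≤ p<m)) ⟩
      (u + m) % N           ≡⟨ toℕ-vtx (u + m) ⟨
      toℕ (vtx (u + m))     ≡⟨ cong toℕ eq ⟨
      toℕ (vtx (u + p))     ≡⟨ toℕ-vtx (u + p) ⟩
      (u + p) % N           ∎
    where open ≡-Reasoning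

  arc-length≤∣_∣ : ∀ {m} D → m ≤ N → ∀ u → (∀ p → p < m → vtx (u + p) ∈ D) → m ≤ ∣ D ∣
  arc-length≤∣_∣ {zero}  D _     u arc = z≤n
  arc-length≤∣_∣ {suc m} D 1+m≤N u arc = ≤-trans (s≤s m≤∣D-last∣) (x∈p⇒∣p-x∣<∣p∣ (arc m ≤-refl))
    where
    m≤∣D-last∣ : m ≤ ∣ D - vtx (u + m) ∣
    m≤∣D-last∣ = arc-length≤∣ D - vtx (u + m) ∣ (<⇒≤ 1+m≤N) u λ p p<m →
      x∈p∧x≢y⇒x∈p-y (arc p (m≤n⇒m≤1+n p<m)) (vtx-injective-on-arc u p<m 1+m≤N)

  Arc : ℕ → Subset N → ℕ → Set
  Arc k A u = ∀ p → p ≤ 4 * k → vtx (u + p) ∈ A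

  Dense⇒Γ-arc : ∀ k {A} b → Dense k (λ q → vtx (b + k + q) ∈ A) → Arc k (Γ C k A) b
  Dense⇒Γ-arc k b dense t t≤4k with dense t t≤4k
  ... | q , q≤t , t≤q+2k , b+k+q∈A = Γ-near k (b + k + q) (b + t) below above b+k+q∈A
    where
    open ≤-Reasoning
    below : b + k + q ≤ b + t + k
    below = begin
      b + k + q ≤⟨ +-monoʳ-≤ (b + k) q≤t ⟩
      b + k + t ≡⟨ solve (b ∷ k ∷ t ∷ []) ⟩
      b + t + k ∎
    above : b + t ≤ b + k + q + k
    above = begin
      b + t           ≤⟨ +-monoʳ-≤ b t≤q+2k ⟩
      b + (q + 2 * k) ≡⟨ solve (b ∷ q ∷ k ∷ []) ⟩
      b + k + q + k   ∎

  arc-split-from : ∀ k {A B} b → (∀ q → q ≤ 4 * k → vtx (b + k + q) ∈ A ⊎ vtx (b + k + q) ∈ B) →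
    vtx (b + k + 0) ∈ A → ∃ (Arc k (Γ C k A)) ⊎ ∃ (Arc k (Γ C k B))
  arc-split-from k {A} {B} b cover first∈A with gap-or-Dense k (λ q → vtx (b + k + q) ∈? A) first∈A
  ... | inj₂ dense = inj₁ (b , Dense⇒Γ-arc k b dense)
  ... | inj₁ (j , j≤2k , gap) = inj₂ (b + j , Dense⇒Γ-arc k (b + j) (Dense-map k in-B (run⇒Dense k gap)))
    where
    in-B : ∀ {q} → q ≤ 2 * k × vtx (b + k + (j + q)) ∉ A → vtx (b + j + k + q) ∈ B
    in-B {q} (q≤2k , ∉A) with cover (j + q) (subst (j + q ≤_) (sym (4k≡2k+2k k)) (+-mono-≤ j≤2k q≤2k))
    ... | inj₁ ∈A = contradiction ∈A ∉A
    ... | inj₂ ∈B =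
      subst (_∈ B) (cong vtx (b + k + (j + q) ≡ b + j + k + q ∋ solve (b ∷ k ∷ j ∷ q ∷ []))) ∈B

  -- u + k * M stands for u − k, avoiding truncated subtraction.
  recentre : ∀ k u q → vtx (u + k * M + k + q) ≡ vtx (u + q)
  recentre k u q = trans (cong vtx rearrange) (vtx-+-*N (u + q) k)
    where
    +-reorder : ∀ u x k q → u + x + k + q ≡ u + q + (k + x)
    +-reorder = solve-∀
    rearrange : u + k * M + k + q ≡ u + q + k * N
    rearrange = trans (+-reorder u (k * M) k q) (cong (u + q +_) (sym (*-suc k M)))

  arc-split : ∀ k {A B} u → (∀ p → p ≤ 4 * k → vtx (u + p) ∈ A ⊎ vtx (u + p) ∈ B) →
    ∃ (Arc k (Γ C k A)) ⊎ ∃ (Arc k (Γ C k B))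
  arc-split k {A} {B} u cover =
    [ arc-split-from k b cover′ , swap ∘ arc-split-from k b (λ q q≤4k → swap (cover′ q q≤4k)) ]
    (cover′ 0 z≤n)
    where
    b : ℕ
    b = u + k * M
    cover′ : ∀ q → q ≤ 4 * k → vtx (b + k + q) ∈ A ⊎ vtx (b + k + q) ∈ B
    cover′ q rewrite recentre k u q = cover q

  arc⇒¬Successful : ∀ k s {m} → m ≤ N → m ≤ suc (4 * k) → s < m →
    ∀ {n} (σ : Strategy N n) {D} u → Arc k D u → ¬ Successful C k s D σ
  arc⇒¬Successful k s {m} m≤N m≤1+4k s<m σ {D} u arc = unsuccessful σ
    where
    large : ¬ ∣ D ∣ ≤ s
    large = <⇒≱ $ <-≤-trans s<m $
      arc-length≤∣ D ∣ m≤N u λ p p<m → arc p (s≤s⁻¹ (≤-trans p<m m≤1+4k))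
    unsuccessful : ∀ {n} (σ : Strategy N n) → ¬ Successful C k s D σ
    unsuccessful done                        = large
    unsuccessful (test T σ₀ σ₁) (inj₁ small) = large small
    unsuccessful (test T σ₀ σ₁) (inj₂ (ok₀ , ok₁))
      with arc-split k u (λ p p≤4k → ∈-split T (arc p p≤4k))
    ... | inj₁ (u₀ , arc₀) = arc⇒¬Successful k s m≤N m≤1+4k s<m σ₀ u₀ arc₀ ok₀
    ... | inj₂ (u₁ , arc₁) = arc⇒¬Successful k s m≤N m≤1+4k s<m σ₁ u₁ arc₁ ok₁

proposition1 : (k N : ℕ) → 1 ≤ k →
    ((1 ≤ N × N ≤ 4 * k) → ∀ s n (σ : Strategy N n) → s < N → ¬ GSuccessful (cycle N) k s σ)
    × (4 * k + 1 ≤ N → ∀ s n (σ : Strategy N n) → s ≤ 4 * k → ¬ GSuccessful (cycle N) k s σ)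
proposition1 k zero    _ = (λ ()) , λ 4k+1≤0 → contradiction (≤-trans (m≤n+m 1 (4 * k)) 4k+1≤0) λ ()
proposition1 k (suc M) _ =
  (λ (_ , N≤4k) s n σ s<N → arc⇒¬Successful k s ≤-refl (m≤n⇒m≤1+n N≤4k) s<N σ 0 full)
  , λ 4k+1≤N s n σ s≤4k →
      arc⇒¬Successful k s (subst (_≤ suc M) (+-comm (4 * k) 1) 4k+1≤N) ≤-refl (s≤s s≤4k) σ 0 full
  where
  open Cycle M
  full : Arc k ⊤ 0
  full _ _ = ∈⊤
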